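{- Let $\mathcal G=(\mathcal N,\mathcal A,\mathcal R)$ be a first-order grammar, $n\in\mathbb N$, and $g:\mathbb N_+\to\mathbb N_+$ a nondecreasing function. Then every eqlevel-decreasing $(n,g)$-sequence (in $\mathcal L^{\mathrm{act}}_{\mathcal G}$) has length at most $\ell_{n,g}$.
   Context: Terms: variables $\mathrm{Var}=\{x_1,x_2,\dots\}$, finite set $\mathcal N$ of nonterminals with arities; terms are rooted ordered (possibly infinite) trees labelled in $\mathcal N\cup\mathrm{Var}$ (variable-nodes are leaves, $A$-nodes have $\mathrm{arity}(A)$ ordered successors); $\mathcal T_{\mathcal N}$ is the set of regular terms (finitely many distinct subterms). For a regular term $E$, $\mathrm{PresSize}(E)$ is the number of distinct subterms of $E$ (the number of nodes of its syntactic graph), and $\mathrm{PresSize}(E,F)=\mathrm{PresSize}(E)+\mathrm{PresSize}(F)$. A substitution $\sigma$ maps variables to terms, with finite support $\mathrm{supp}(\sigma)=\{x_i\mid\sigma(x_i)\ne x_i\}$; $E\sigma$ replaces each $x_i$ by $\sigma(x_i)$. First-order grammar $\mathcal G=(\mathcal N,\mathcal A,\mathcal R)$: finite action set $\mathcal A$, finite set of rules $A(x_1,\dots,x_m)\xrightarrow{a}E$, $m=\mathrm{arity}(A)$, $E$ a finite term with variables among $x_1,\dots,x_m$. LTS $\mathcal L^{\mathrm{act}}_{\mathcal G}$: states $\mathcal T_{\mathcal N}$, transitions $(A(x_1,\dots,x_m))\tau\xrightarrow{a}E\tau$ for every rule and every substitution $\tau$. $\sim_0$ is total; $T\sim_{k+1}U$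 iff each $T\xrightarrow{a}T'$ is matched by some $U\xrightarrow{a}U'$ with $T'\sim_kU'$ and vice versa, with the convention $x_i\not\sim_1H$ for every term $H\neq x_i$. $\sim=\bigcap_k\sim_k$, $\mathrm{EqL}(T,U)=\max\{k\in\mathbb N\cup\{\omega\}\mid T\sim_kU\}$. A sequence $(V_1,V'_1),(V_2,V'_2),\dots$ of pairs of terms is eqlevel-decreasing if $\omega>\mathrm{EqL}(V_1,V'_1)>\mathrm{EqL}(V_2,V'_2)>\cdots$. It is an $(n,g)$-sequence if it can be written as $(E_1\sigma,F_1\sigma),(E_2\sigma,F_2\sigma),\dots$ for a single substitution $\sigma$ with $|\mathrm{supp}(\sigma)|\le n$ and terms $E_j,F_j$ with $\mathrm{PresSize}(E_j,F_j)\le g(j)$ for all $j$. Let $\mathrm{SInc}=\max\{\mathrm{PresSize}(E)\mid E$ is the right-hand side of a rule in $\mathcal R\}$. For $b\in\mathbb N$ let $\mathrm{Size}_{\le b}=\{(E,F)\mid\mathrm{PresSize}(E,F)\le b\}$ and $\mathrm{BMEL}_b=\max\{\mathrm{EqL}(E,F)\mid (E,F)\in\mathrm{Size}_{\le b},\ E\not\sim F\}$ (with $\max\emptyset=0$). Define $\ell_{n,g}$ recursively: $\ell_{0,g}=1+\mathrm{BMEL}_{g(1)}$ and $\ell_{n+1,g}=1+\mathrm{BMEL}_{g(1)}+\ell_{n,g'}$, where $g'(j)=g(1+\mathrm{BMEL}_{g(1)}+j)+2\cdot(g(1)+\mathrm{BMEL}_{g(1)}\cdot\mathrm{SInc})$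 for all $j\in\mathbb N_+$. -}

module Defs where

open import Data.Nat using (ℕ; zero; suc; _+_; _*_; _≤_; _<_; _<?_)
open import Data.Fin using (Fin; fromℕ<; toℕ)
open import Data.List using (List; []; _∷_; _++_; length)
open import Data.List.Membership.Propositional using (_∈_; _∉_)
open import Data.List.Relation.Unary.All using (All)
open import Data.Maybe using (Maybe; just; nothing)
open import Data.Product using (Σ; ∃; ∃-syntax; _×_; _,_; proj₁; proj₂)
open import Data.Sum using (_⊎_)
open import Data.Unit using (⊤)
open import Data.Empty using (⊥)
open import Relation.Nullary using (¬_; yes; no)
open import Relation.Binary.PropositionalEquality using (_≡_)

-- Variables are x_0, x_1, ... (indexed by ℕ; a harmless renaming of x_1,x_2,...).
data Label (nN : ℕ) : Set where
  var : ℕ → Label nN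
  nt  : Fin nN → Label nN

data FTerm (nN : ℕ) (arity : Fin nN → ℕ) : Set where
  fvar : ℕ → FTerm nN arity
  fapp : (A : Fin nN) → (Fin (arity A) → FTerm nN arity) → FTerm nN arity

VarsBelow : ∀ {nN arity} → ℕ → FTerm nN arity → Set
VarsBelow m (fvar i)    = i < m
VarsBelow m (fapp A cs) = ∀ j → VarsBelow m (cs j)

-- a rule  A(x_0,…,x_(m-1)) --a--> E
record Rule (nN : ℕ) (arity : Fin nN → ℕ) (nA : ℕ) : Set where
  constructor mkRule
  field
    lhs : Fin nN
    act : Fin nA
    rhs : FTerm nN arity

record Grammar : Set where
  field
    nN     : ℕ
    arity  : Fin nN → ℕ
    nA     : ℕ
    rules  : List (Rule nN arity nA)
    rulesOK : All (λ r → VarsBelow (arity (Rule.lhs r)) (Rule.rhs r)) rules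

module _ (G : Grammar) where
  open Grammar G

  -- (possibly infinite) terms: a tree is given by the (partial) labelling
  -- of positions (paths of successor indices, 0-based).
  Tree : Set
  Tree = List ℕ → Maybe (Label nN)

  Defined : Maybe (Label nN) → Set
  Defined m = ∃[ l ] m ≡ just l

  ChildOK : Maybe (Label nN) → Maybe (Label nN) → ℕ → Set
  ChildOK (just (nt A)) c d = (d < arity A × Defined c) ⊎ (arity A ≤ d × c ≡ nothing)
  ChildOK _             c d = c ≡ nothing

  -- a tree is a well-formed term: root exists; A-nodes have exactly
  -- arity(A) ordered successors; variable nodes are leaves
  WF : Tree → Set
  WF t = Defined (t []) × (∀ p d → ChildOK (t p) (t (p ++ (d ∷ []))) d)

  _≅_ : Tree → Tree → Set
  T ≅ U = ∀ p → T p ≡ U p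

  sub : Tree → List ℕ → Tree
  sub t p q = t (p ++ q)

  embed : FTerm nN arity → Tree
  embed (fvar i)    []      = just (var i)
  embed (fvar i)    (_ ∷ _) = nothing
  embed (fapp A cs) []      = just (nt A)
  embed (fapp A cs) (d ∷ p) with d <? arity A
  ... | yes h = embed (cs (fromℕ< h)) p
  ... | no _  = nothing

  varT : ℕ → Tree
  varT i = embed (fvar i)

  subst : Tree → (ℕ → Tree) → Tree
  subst t σ []      with t []
  ... | just (var i) = σ i []
  ... | l            = l
  subst t σ (d ∷ p) with t []
  ... | just (var i) = σ i (d ∷ p)
  ... | just (nt A)  = subst (λ q → t (d ∷ q)) σ p
  ... | nothing      = nothing

  -- the successor of T by rule r:  (A(x_0..x_(m-1)))τ --a--> E τ,
  -- where τ(x_i) is the i-th successor of the root of T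
  succT : Rule nN arity nA → Tree → Tree
  succT r T = subst (embed (Rule.rhs r)) (λ i → sub T (i ∷ []))

  -- stratified equivalences ~_k (with the convention x_i ≁_1 H for H ≠ x_i)
  mutual
    Sim : ℕ → Tree → Tree → Set
    Sim zero    T U = ⊤
    Sim (suc k) T U = SimStep k T U (T []) (U [])

    SimStep : ℕ → Tree → Tree → Maybe (Label nN) → Maybe (Label nN) → Set
    SimStep k T U (just (var i)) (just (var j)) = i ≡ j
    SimStep k T U (just (nt A))  (just (nt B))  =
      (∀ r → r ∈ rules → Rule.lhs r ≡ A →
         ∃[ r' ] (r' ∈ rules × Rule.lhs r' ≡ B × Rule.act r' ≡ Rule.act r
                  × Sim k (succT r T) (succT r' U)))
      ×
      (∀ r' → r' ∈ rules → Rule.lhs r' ≡ B →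
         ∃[ r ] (r ∈ rules × Rule.lhs r ≡ A × Rule.act r ≡ Rule.act r'
                 × Sim k (succT r T) (succT r' U)))
    SimStep k T U _ _ = ⊥

  Equiv : Tree → Tree → Set
  Equiv T U = ∀ k → Sim k T U

  EqLIs : Tree → Tree → ℕ → Set
  EqLIs T U k = Sim k T U × ¬ Sim (suc k) T U

  HasPresSize : Tree → ℕ → Set
  HasPresSize t s =
    Σ (Fin s → Tree) λ L →
      (∀ i → ∃[ p ] (Defined (t p) × L i ≅ sub t p))
      × (∀ i j → L i ≅ L j → i ≡ j)
      × (∀ p → Defined (t p) → ∃[ i ] (sub t p ≅ L i))

  Regular : Tree → Set
  Regular t = WF t × ∃[ s ] HasPresSize t s

  PresSizeLe : Tree → Tree → ℕ → Set
  PresSizeLe E F b = ∃[ s ] ∃[ s' ] (HasPresSize E s × HasPresSize F s' × s + s' ≤ b)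

  IsBMEL : ℕ → ℕ → Set
  IsBMEL b m =
    (∀ E F k → Regular E → Regular F → PresSizeLe E F b → ¬ Equiv E F →
       EqLIs E F k → k ≤ m)
    × (m ≡ 0 ⊎ ∃[ E ] ∃[ F ] (Regular E × Regular F × PresSizeLe E F b
                              × ¬ Equiv E F × EqLIs E F m))

  IsSInc : ℕ → Set
  IsSInc s =
    (∀ r → r ∈ rules → ∀ p → HasPresSize (embed (Rule.rhs r)) p → p ≤ s)
    × (s ≡ 0 ⊎ ∃[ r ] (r ∈ rules × HasPresSize (embed (Rule.rhs r)) s))

  SuppBound : ℕ → (ℕ → Tree) → Set
  SuppBound n σ = Σ (List ℕ) λ S → (length S ≤ n × (∀ i → i ∉ S → σ i ≅ varT i))

  -- eqlevel-decreasing sequence (V_1,V'_1),…,(V_L,V'_L)  (index j ↦ j+1)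
  EqlevelDecreasing : (L : ℕ) → (Fin L → Tree × Tree) → Set
  EqlevelDecreasing L V =
    Σ (Fin L → ℕ) λ e → ((∀ j → EqLIs (proj₁ (V j)) (proj₂ (V j)) (e j))
            × (∀ i j → toℕ i < toℕ j → e j < e i))

  IsNGSeq : ℕ → (ℕ → ℕ) → (L : ℕ) → (Fin L → Tree × Tree) → Set
  IsNGSeq n g L V =
    Σ (ℕ → Tree) λ σ → ((∀ i → WF (σ i)) × SuppBound n σ ×
      Σ (Fin L → Tree) λ E → Σ (Fin L → Tree) λ F → ((∀ j → WF (E j) × WF (F j))
        × (∀ j → PresSizeLe (E j) (F j) (g (suc (toℕ j))))
        × (∀ j → (proj₁ (V j) ≅ subst (E j) σ) × (proj₂ (V j) ≅ subst (F j) σ))))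

-- ℓ_{n,g}, given the values BMEL_b (bmel b) and SInc (sinc)
ell : (ℕ → ℕ) → ℕ → ℕ → (ℕ → ℕ) → ℕ
ell bmel sinc zero    g = 1 + bmel (g 1)
ell bmel sinc (suc n) g =
  1 + bmel (g 1) + ell bmel sinc n (λ j → g (1 + bmel (g 1) + j) + 2 * (g 1 + bmel (g 1) * sinc))

-- Write the sequence as (E_jσ, F_jσ), j < L, with eq-levels e_0 > e_1 > ⋯, and
-- let c = 1 + BMEL_{g(1)}.  If L ≤ c we are done.  Otherwise E_0 ≁ F_0 (else
-- E_0σ ~ F_0σ), so E_0, F_0 are separated at a level k ≤ BMEL_{g(1)} < e_0.
-- The mismatch lemma follows d < k separating transitions to a variable x_i
-- of σ facing a term H ≠ x_i with σ(x_i) ∼_K Hσ and K + d ≥ e_0, hence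
-- K > e_j for all j ≥ c.  Variable elimination replaces x_i by the regular
-- term H^ω = H[x_i ↦ H^ω]: t σ ∼_K t[x_i ↦ H^ω] σ′ where σ′ drops x_i from the
-- support.  So the pairs from index c on form an eqlevel-decreasing
-- (n−1, g′)-sequence, and induction on n gives L ≤ c + ℓ_{n−1,g′} = ℓ_{n,g}.
--
-- Classical steps
-- (least failing level, deduplicating covers) live in the double-negation
-- monad, which suffices because the conclusion L ≤ ℓ_{n,g} is decidable.

module Submission where

open import Defs
open import Data.Nat using (ℕ; zero; suc; _+_; _*_; _∸_; _≤_; _<_; _<?_; _≤?_; _≟_; z≤n; s≤s; s≤s⁻¹)
open import Data.Nat.Properties
open import Data.Nat.Solver using (module +-*-Solver)
open import Data.Fin as Fin using (Fin; fromℕ<; toℕ)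
open import Data.Fin.Properties using (toℕ-fromℕ<)
open import Data.List using (List; []; _∷_; _++_; length; map; filter; lookup; tabulate; concat)
open import Data.List.Properties using (length-++; length-map; length-tabulate; filter-notAll)
open import Data.List.Membership.Propositional using (_∈_; _∉_)
open import Data.List.Membership.Propositional.Properties using (∈-map⁺; ∈-++⁺ˡ; ∈-++⁺ʳ; ∈-filter⁺; ∈-tabulate⁺; ∈-lookup; ∈-concat⁺′)
open import Data.List.Membership.DecPropositional _≟_ using (_∈?_)
open import Data.List.Relation.Unary.Any as Any using (Any; here; there)
open import Data.List.Relation.Unary.All as All using (All)
open import Data.List.Relation.Unary.Any.Properties using (lookup-index)
open import Data.List.Relation.Unary.AllPairs using (AllPairs; []; _∷_)
open import Data.Maybe using (Maybe; just; nothing)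
open import Data.Product using (Σ; ∃; ∃-syntax; _×_; _,_; proj₁; proj₂)
open import Data.Sum using (_⊎_; inj₁; inj₂)
open import Data.Unit using (⊤; tt)
open import Data.Empty using (⊥; ⊥-elim)
open import Relation.Nullary using (¬_; yes; no; Dec; ¬?)
open import Relation.Nullary.Decidable using (decidable-stable; ¬¬-excluded-middle)
open import Relation.Nullary.Negation using (¬¬-Monad)
open import Effect.Monad using (RawMonad)
open import Level using (0ℓ)
open import Relation.Binary.PropositionalEquality
  using (_≡_; refl; sym; trans; cong; cong₂) renaming (subst to ≡-subst; subst₂ to ≡-subst₂)

open RawMonad (¬¬-Monad {0ℓ}) using (_>>=_; pure)

module Proof (G : Grammar) where
  open Grammar G

  Term : Set
  Term = Tree G

  infix 4 _≈_
  _≈_ : Term → Term → Set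
  _≈_ = _≅_ G

  ≈-refl : ∀ {T} → T ≈ T
  ≈-refl p = refl

  ≈-sym : ∀ {T U} → T ≈ U → U ≈ T
  ≈-sym e p = sym (e p)

  ≈-trans : ∀ {T U W} → T ≈ U → U ≈ W → T ≈ W
  ≈-trans e f p = trans (e p) (f p)

  infixl 8 _⟪_⟫
  _⟪_⟫ : Term → (ℕ → Term) → Term
  _⟪_⟫ = subst G

  x[_] : ℕ → Term
  x[_] = varT G

  child : Term → ℕ → Term
  child T d q = T (d ∷ q)

  Def : Maybe (Label nN) → Set
  Def = Defined G

  def-cast : ∀ {a a′} → a ≡ a′ → Def a′ → Def a
  def-cast refl h = h

  var-injective : ∀ {i j} → just (var {nN} i) ≡ just (var j) → i ≡ j
  var-injective refl = refl

  subst-var : ∀ t σ i → t [] ≡ just (var i) → t ⟪ σ ⟫ ≈ σ i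
  subst-var t σ i eq [] rewrite eq = refl
  subst-var t σ i eq (d ∷ p) rewrite eq = refl

  subst-nt-root : ∀ t σ A → t [] ≡ just (nt A) → (t ⟪ σ ⟫) [] ≡ just (nt A)
  subst-nt-root t σ A eq rewrite eq = refl

  subst-nt-child : ∀ t σ A → t [] ≡ just (nt A) → ∀ d → child (t ⟪ σ ⟫) d ≈ child t d ⟪ σ ⟫
  subst-nt-child t σ A eq d q rewrite eq = refl

  subst-undefined : ∀ t σ → t [] ≡ nothing → ∀ p → (t ⟪ σ ⟫) p ≡ nothing
  subst-undefined t σ eq [] rewrite eq = refl
  subst-undefined t σ eq (d ∷ p) rewrite eq = refl

  subst-resp : ∀ {t t′ σ σ'} → t ≈ t′ → (∀ l → σ l ≈ σ' l) → t ⟪ σ ⟫ ≈ t′ ⟪ σ' ⟫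
  subst-resp {t} {t′} e f [] with t [] | t′ [] | e []
  ... | just (var i) | _ | refl = f i []
  ... | just (nt A)  | _ | refl = refl
  ... | nothing      | _ | refl = refl
  subst-resp {t} {t′} e f (d ∷ p) with t [] | t′ [] | e []
  ... | just (var i) | _ | refl = f i (d ∷ p)
  ... | just (nt A)  | _ | refl = subst-resp (λ q → e (d ∷ q)) f p
  ... | nothing      | _ | refl = refl

  subst-respˡ : ∀ {t t′} σ → t ≈ t′ → t ⟪ σ ⟫ ≈ t′ ⟪ σ ⟫
  subst-respˡ σ e = subst-resp e (λ _ → ≈-refl)

  subst-comp : ∀ t σ τ → t ⟪ σ ⟫ ⟪ τ ⟫ ≈ t ⟪ (λ l → σ l ⟪ τ ⟫) ⟫
  subst-comp t σ τ p with t [] in eq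
  ... | just (var i) =
    ≈-trans (subst-respˡ τ (subst-var t σ i eq)) (≈-sym (subst-var t _ i eq)) p
  ... | nothing =
    trans (subst-undefined (t ⟪ σ ⟫) τ (subst-undefined t σ eq []) p) (sym (subst-undefined t _ eq p))
  ... | just (nt A) = at p
    where
    at : ∀ p → (t ⟪ σ ⟫ ⟪ τ ⟫) p ≡ (t ⟪ (λ l → σ l ⟪ τ ⟫) ⟫) p
    at [] = trans (subst-nt-root (t ⟪ σ ⟫) τ A (subst-nt-root t σ A eq)) (sym (subst-nt-root t _ A eq))
    at (d ∷ p) = trans (subst-nt-child (t ⟪ σ ⟫) τ A (subst-nt-root t σ A eq) d p)
                 (trans (subst-respˡ τ (subst-nt-child t σ A eq d) p)
                 (trans (subst-comp (child t d) σ τ p) (sym (subst-nt-child t _ A eq d p))))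

  next : Rule nN arity nA → Term → Term
  next = succT G

  next-resp : ∀ r {T T′} → T ≈ T′ → next r T ≈ next r T′
  next-resp r e = subst-resp (λ _ → refl) (λ l q → e (l ∷ q))

  next-subst : ∀ r T σ A → T [] ≡ just (nt A) → next r (T ⟪ σ ⟫) ≈ next r T ⟪ σ ⟫
  next-subst r T σ A eq =
    ≈-trans (subst-resp (λ _ → refl) (λ l → subst-nt-child T σ A eq l))
            (≈-sym (subst-comp (embed G (Rule.rhs r)) (child T) σ))

  infix 4 _∼[_]_
  _∼[_]_ : Term → ℕ → Term → Set
  T ∼[ k ] U = Sim G k T U

  SimAt : ℕ → Term → Term → Maybe (Label nN) → Maybe (Label nN) → Set
  SimAt = SimStep G

  simAt-intro : ∀ {k T U a a′ b b′} → a ≡ a′ → b ≡ b′ → SimAt k T U a′ b′ → SimAt k T U a b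
  simAt-intro refl refl s = s

  simAt-elim : ∀ {k T U a a′ b b′} → a ≡ a′ → b ≡ b′ → SimAt k T U a b → SimAt k T U a′ b′
  simAt-elim refl refl s = s

  mutual
    sim-resp : ∀ k {T U T′ U′} → T ∼[ k ] U → T ≈ T′ → U ≈ U′ → T′ ∼[ k ] U′
    sim-resp zero s e f = tt
    sim-resp (suc k) {T} {U} s e f rewrite sym (e []) | sym (f []) = simAt-resp k (T []) (U []) s e f

    simAt-resp : ∀ k {T U T′ U′} a b → SimAt k T U a b → T ≈ T′ → U ≈ U′ → SimAt k T′ U′ a b
    simAt-resp k (just (var i)) (just (var j)) s e f = s
    simAt-resp k (just (nt A)) (just (nt B)) (fwd , bwd) e f =
      (λ r m q → let (r′ , m′ , q′ , a , s) = fwd r m q in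
                 r′ , m′ , q′ , a , sim-resp k s (next-resp r e) (next-resp r′ f)) ,
      (λ r′ m′ q′ → let (r , m , q , a , s) = bwd r′ m′ q′ in
                 r , m , q , a , sim-resp k s (next-resp r e) (next-resp r′ f))
    simAt-resp k (just (var _)) (just (nt _)) () e f
    simAt-resp k (just (nt _)) (just (var _)) () e f
    simAt-resp k (just (var _)) nothing () e f
    simAt-resp k (just (nt _)) nothing () e f
    simAt-resp k nothing b () e f

  mutual
    sim-pred : ∀ k T U → T ∼[ suc k ] U → T ∼[ k ] U
    sim-pred zero T U s = tt
    sim-pred (suc k) T U s = simAt-pred k (T []) (U []) s

    simAt-pred : ∀ k {T U} a b → SimAt (suc k) T U a b → SimAt k T U a b
    simAt-pred k (just (var i)) (just (var j)) s = s
    simAt-pred k (just (nt A)) (just (nt B)) (fwd , bwd) =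
      (λ r m q → let (r′ , m′ , q′ , a , s) = fwd r m q in r′ , m′ , q′ , a , sim-pred k _ _ s) ,
      (λ r′ m′ q′ → let (r , m , q , a , s) = bwd r′ m′ q′ in r , m , q , a , sim-pred k _ _ s)
    simAt-pred k (just (var _)) (just (nt _)) ()
    simAt-pred k (just (nt _)) (just (var _)) ()
    simAt-pred k (just (var _)) nothing ()
    simAt-pred k (just (nt _)) nothing ()
    simAt-pred k nothing b ()

  sim-≤ : ∀ {k K T U} → k ≤ K → T ∼[ K ] U → T ∼[ k ] U
  sim-≤ {k} {zero} z≤n s = s
  sim-≤ {k} {suc K} le s with k ≟ suc K
  ... | yes refl = s
  ... | no ne = sim-≤ (s≤s⁻¹ (≤∧≢⇒< le ne)) (sim-pred K _ _ s)

  mutual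
    sim-sym : ∀ k {T U} → T ∼[ k ] U → U ∼[ k ] T
    sim-sym zero s = tt
    sim-sym (suc k) {T} {U} s = simAt-sym k (T []) (U []) s

    simAt-sym : ∀ k {T U} a b → SimAt k T U a b → SimAt k U T b a
    simAt-sym k (just (var i)) (just (var j)) s = sym s
    simAt-sym k (just (nt A)) (just (nt B)) (fwd , bwd) =
      (λ r′ m′ q′ → let (r , m , q , a , s) = bwd r′ m′ q′ in r , m , q , a , sim-sym k s) ,
      (λ r m q → let (r′ , m′ , q′ , a , s) = fwd r m q in r′ , m′ , q′ , a , sim-sym k s)
    simAt-sym k (just (var _)) (just (nt _)) ()
    simAt-sym k (just (nt _)) (just (var _)) ()
    simAt-sym k (just (var _)) nothing ()
    simAt-sym k (just (nt _)) nothing ()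
    simAt-sym k nothing b ()

  mutual
    sim-trans : ∀ k {T U W} → T ∼[ k ] U → U ∼[ k ] W → T ∼[ k ] W
    sim-trans zero s t = tt
    sim-trans (suc k) {T} {U} {W} s t = simAt-trans k (T []) (U []) (W []) s t

    simAt-trans : ∀ k {T U W} a b c → SimAt k T U a b → SimAt k U W b c → SimAt k T W a c
    simAt-trans k (just (var i)) (just (var j)) (just (var l)) s t = trans s t
    simAt-trans k (just (nt A)) (just (nt B)) (just (nt C)) (s-fwd , s-bwd) (t-fwd , t-bwd) =
      (λ r m q → let (r′ , m′ , q′ , a , s) = s-fwd r m q in
                 let (r′' , m′' , q′' , a′ , t) = t-fwd r′ m′ q′ in
                 r′' , m′' , q′' , trans a′ a , sim-trans k s t) ,
      (λ r′' m′' q′' → let (r′ , m′ , q′ , a′ , t) = t-bwd r′' m′' q′' in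
                 let (r , m , q , a , s) = s-bwd r′ m′ q′ in
                 r , m , q , trans a a′ , sim-trans k s t)
    simAt-trans k (just (var _)) (just (var _)) (just (nt _)) s ()
    simAt-trans k (just (var _)) (just (var _)) nothing s ()
    simAt-trans k (just (nt _)) (just (nt _)) (just (var _)) s ()
    simAt-trans k (just (nt _)) (just (nt _)) nothing s ()
    simAt-trans k (just (var _)) (just (nt _)) c () t
    simAt-trans k (just (nt _)) (just (var _)) c () t
    simAt-trans k (just (var _)) nothing c () t
    simAt-trans k (just (nt _)) nothing c () t
    simAt-trans k nothing b c () t

  ChildOK′ : Maybe (Label nN) → Maybe (Label nN) → ℕ → Set
  ChildOK′ = ChildOK G

  LocallyWF : Term → Set
  LocallyWF t = ∀ p d → ChildOK′ (t p) (t (p ++ (d ∷ []))) d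

  IsTerm : Term → Set
  IsTerm = WF G

  childOK-cast : ∀ {a a′ b b′ d} → a ≡ a′ → b ≡ b′ → ChildOK′ a′ b′ d → ChildOK′ a b d
  childOK-cast refl refl c = c

  LocallyWF-child : ∀ t d → LocallyWF t → LocallyWF (child t d)
  LocallyWF-child t d w p = w (d ∷ p)

  IsTerm-child : ∀ t d → IsTerm t → Def (t (d ∷ [])) → IsTerm (child t d)
  IsTerm-child t d w dp = dp , LocallyWF-child t d (proj₂ w)

  IsLeaf : Maybe (Label nN) → Set
  IsLeaf (just (nt _)) = ⊥
  IsLeaf _ = ⊤

  leaf-child : ∀ t → LocallyWF t → IsLeaf (t []) → ∀ d → t (d ∷ []) ≡ nothing
  leaf-child t w leaf d with t [] | w [] d
  leaf-child t w leaf d | just (var _) | c = c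
  leaf-child t w leaf d | nothing | c = c

  embed-root : ∀ f → Def (embed G f [])
  embed-root (fvar i) = var i , refl
  embed-root (fapp A cs) = nt A , refl

  embed-LocallyWF : ∀ f → LocallyWF (embed G f)
  embed-LocallyWF (fvar i) [] d = refl
  embed-LocallyWF (fvar i) (x ∷ p) d = refl
  embed-LocallyWF (fapp A cs) [] d with d <? arity A
  ... | yes h = inj₁ (h , embed-root (cs (fromℕ< h)))
  ... | no h = inj₂ (≮⇒≥ h , refl)
  embed-LocallyWF (fapp A cs) (x ∷ p) d with x <? arity A
  ... | yes h = embed-LocallyWF (cs (fromℕ< h)) p d
  ... | no h = refl

  embed-IsTerm : ∀ f → IsTerm (embed G f)
  embed-IsTerm f = embed-root f , embed-LocallyWF f

  x-IsTerm : ∀ i → IsTerm x[ i ]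
  x-IsTerm i = embed-IsTerm (fvar i)

  embed-vars : ∀ m f p l → VarsBelow m f → embed G f p ≡ just (var l) → l < m
  embed-vars m (fvar i) [] l vb refl = vb
  embed-vars m (fapp A cs) (x ∷ p) l vb eq with x <? arity A
  ... | yes h = embed-vars m (cs (fromℕ< h)) p l (vb (fromℕ< h)) eq

  VarsAreTerms : Term → (ℕ → Term) → Set
  VarsAreTerms t σ = ∀ p l → t p ≡ just (var l) → IsTerm (σ l)

  subst-LocallyWF : ∀ t σ → LocallyWF t → VarsAreTerms t σ → LocallyWF (t ⟪ σ ⟫)
  subst-LocallyWF t σ w vw p d with t [] in eq
  subst-LocallyWF t σ w vw p d | just (var l) =
    childOK-cast (subst-var t σ l eq p) (subst-var t σ l eq (p ++ (d ∷ []))) (proj₂ (vw [] l eq) p d)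
  subst-LocallyWF t σ w vw p d | nothing =
    childOK-cast (subst-undefined t σ eq p) (subst-undefined t σ eq (p ++ (d ∷ []))) refl
  subst-LocallyWF t σ w vw (x ∷ p) d | just (nt A) =
    childOK-cast (subst-nt-child t σ A eq x p) (subst-nt-child t σ A eq x (p ++ (d ∷ [])))
      (subst-LocallyWF (child t x) σ (LocallyWF-child t x w) (λ q → vw (x ∷ q)) p d)
  subst-LocallyWF t σ w vw [] d | just (nt A) =
    childOK-cast (subst-nt-root t σ A eq) (subst-nt-child t σ A eq d []) (rootChild (t []) eq (w [] d))
    where
    childRoot : ∀ lab → t (d ∷ []) ≡ just lab → Def ((child t d ⟪ σ ⟫) [])
    childRoot (var l) e = def-cast (subst-var (child t d) σ l e []) (proj₁ (vw (d ∷ []) l e))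
    childRoot (nt B) e = def-cast (subst-nt-root (child t d) σ B e) (nt B , refl)
    rootChild : ∀ m → m ≡ just (nt A) → ChildOK′ m (t (d ∷ [])) d →
                ChildOK′ (just (nt A)) ((child t d ⟪ σ ⟫) []) d
    rootChild _ refl (inj₁ (lt , (lab , e))) = inj₁ (lt , childRoot lab e)
    rootChild _ refl (inj₂ (ge , e)) = inj₂ (ge , subst-undefined (child t d) σ e [])

  subst-root : ∀ t σ → Def (t []) → VarsAreTerms t σ → Def ((t ⟪ σ ⟫) [])
  subst-root t σ (var l , e) vw = def-cast (subst-var t σ l e []) (proj₁ (vw [] l e))
  subst-root t σ (nt A , e) vw = def-cast (subst-nt-root t σ A e) (nt A , refl)

  subst-IsTerm : ∀ t σ → IsTerm t → VarsAreTerms t σ → IsTerm (t ⟪ σ ⟫)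
  subst-IsTerm t σ w vw = subst-root t σ (proj₁ w) vw , subst-LocallyWF t σ (proj₂ w) vw

  -- Successors of terms are terms: each variable x_l of the rule is below the
  -- arity of the root, so the l-th child exists.
  next-IsTerm : ∀ r T A → IsTerm T → T [] ≡ just (nt A) → r ∈ rules → Rule.lhs r ≡ A → IsTerm (next r T)
  next-IsTerm r T A w eq m lq = subst-IsTerm (embed G (Rule.rhs r)) (child T) (embed-IsTerm (Rule.rhs r)) childIsTerm
    where
    childIsTerm : VarsAreTerms (embed G (Rule.rhs r)) (child T)
    childIsTerm p l e = IsTerm-child T l w (childDefined (T []) eq (proj₂ w [] l))
      where
      l<arity : l < arity A
      l<arity = ≡-subst (λ B → l < arity B) lq (embed-vars _ (Rule.rhs r) p l (All.lookup rulesOK m) e)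
      childDefined : ∀ m → m ≡ just (nt A) → ChildOK′ m (T (l ∷ [])) l → Def (T (l ∷ []))
      childDefined _ refl (inj₁ (_ , x)) = x
      childDefined _ refl (inj₂ (ge , _)) = ⊥-elim (<⇒≱ l<arity ge)

  sim-refl : ∀ k T → IsTerm T → T ∼[ k ] T
  sim-refl zero T w = tt
  sim-refl (suc k) T w = atRoot (proj₁ w)
    where
    atRoot : Def (T []) → T ∼[ suc k ] T
    atRoot (var i , eq) = simAt-intro eq eq refl
    atRoot (nt A , eq) =
      simAt-intro eq eq ((λ r m q → r , m , q , refl , nextSelf r m q) , (λ r m q → r , m , q , refl , nextSelf r m q))
      where
      nextSelf : ∀ r → r ∈ rules → Rule.lhs r ≡ A → next r T ∼[ k ] next r T
      nextSelf r m q = sim-refl k (next r T) (next-IsTerm r T A w eq m q)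

  -- Congruence: if σ(x_l) ∼_k τ(x_l) for all l then t⟪σ⟫ ∼_k t⟪τ⟫.  At a
  -- nonterminal root one step is gained for free, since the root is shared.
  mutual
    sim-cong : ∀ k t σ τ → IsTerm t → (∀ l → σ l ∼[ k ] τ l) → t ⟪ σ ⟫ ∼[ k ] t ⟪ τ ⟫
    sim-cong zero t σ τ w h = tt
    sim-cong (suc k) t σ τ w h with proj₁ w
    ... | var l , eq = sim-resp (suc k) (h l) (≈-sym (subst-var t σ l eq)) (≈-sym (subst-var t τ l eq))
    ... | nt A , eq = sim-cong-nt k t σ τ A eq w (λ l → sim-pred k _ _ (h l))

    sim-cong-nt : ∀ k t σ τ A → t [] ≡ just (nt A) → IsTerm t → (∀ l → σ l ∼[ k ] τ l) →
                  t ⟪ σ ⟫ ∼[ suc k ] t ⟪ τ ⟫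
    sim-cong-nt k t σ τ A eq w h =
      simAt-intro (subst-nt-root t σ A eq) (subst-nt-root t τ A eq)
        ((λ r m q → r , m , q , refl , nextCong r m q) , (λ r m q → r , m , q , refl , nextCong r m q))
      where
      nextCong : ∀ r → r ∈ rules → Rule.lhs r ≡ A → next r (t ⟪ σ ⟫) ∼[ k ] next r (t ⟪ τ ⟫)
      nextCong r m q = sim-resp k (sim-cong k (next r t) σ τ (next-IsTerm r t A w eq m q) h)
          (≈-sym (next-subst r t σ A eq)) (≈-sym (next-subst r t τ A eq))

  sim-cong-guarded : ∀ k t σ τ i → IsTerm t → (∀ l → σ l ∼[ k ] τ l) →
                     (∀ l → ¬ l ≡ i → σ l ∼[ suc k ] τ l) → ¬ t [] ≡ just (var i) →
                     t ⟪ σ ⟫ ∼[ suc k ] t ⟪ τ ⟫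
  sim-cong-guarded k t σ τ i w h h′ nv with proj₁ w
  ... | nt A , eq = sim-cong-nt k t σ τ A eq w h
  ... | var l , eq = sim-resp (suc k) (h′ l l≢i) (≈-sym (subst-var t σ l eq)) (≈-sym (subst-var t τ l eq))
    where
    l≢i : ¬ l ≡ i
    l≢i refl = nv eq

  sim-subst : ∀ k E F σ → IsTerm E → IsTerm F → (∀ l → IsTerm (σ l)) → E ∼[ k ] F → E ⟪ σ ⟫ ∼[ k ] F ⟪ σ ⟫
  sim-subst zero E F σ wE wF wσ s = tt
  sim-subst (suc k) E F σ wE wF wσ s with proj₁ wE | proj₁ wF
  ... | var i , e₁ | var j , e₂ with simAt-elim e₁ e₂ s
  ...   | refl = sim-resp (suc k) (sim-refl (suc k) (σ i) (wσ i)) (≈-sym (subst-var E σ i e₁)) (≈-sym (subst-var F σ i e₂))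
  sim-subst (suc k) E F σ wE wF wσ s | var i , e₁ | nt B , e₂ with simAt-elim e₁ e₂ s
  ...   | ()
  sim-subst (suc k) E F σ wE wF wσ s | nt A , e₁ | var j , e₂ with simAt-elim e₁ e₂ s
  ...   | ()
  sim-subst (suc k) E F σ wE wF wσ s | nt A , e₁ | nt B , e₂ with simAt-elim e₁ e₂ s
  ...   | (fwd , bwd) = simAt-intro (subst-nt-root E σ A e₁) (subst-nt-root F σ B e₂)
        ((λ r m q → let (r′ , m′ , q′ , a , x) = fwd r m q in r′ , m′ , q′ , a , lift r r′ m q m′ q′ x) ,
         (λ r′ m′ q′ → let (r , m , q , a , x) = bwd r′ m′ q′ in r , m , q , a , lift r r′ m q m′ q′ x))
      where
      lift : ∀ r r′ → r ∈ rules → Rule.lhs r ≡ A → r′ ∈ rules → Rule.lhs r′ ≡ B →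
             next r E ∼[ k ] next r′ F → next r (E ⟪ σ ⟫) ∼[ k ] next r′ (F ⟪ σ ⟫)
      lift r r′ m q m′ q′ x = sim-resp k
        (sim-subst k (next r E) (next r′ F) σ (next-IsTerm r E A wE e₁ m q) (next-IsTerm r′ F B wF e₂ m′ q′) wσ x)
        (≈-sym (next-subst r E σ A e₁)) (≈-sym (next-subst r′ F σ B e₂))

  least-failure : (P : ℕ → Set) (N : ℕ) → P 0 → ¬ P N → ¬ ¬ (∃ λ k → P k × ¬ P (suc k))
  least-failure P zero p0 ¬pN = ⊥-elim (¬pN p0)
  least-failure P (suc N) p0 ¬pN = do
    no ¬pN-1 ← ¬¬-excluded-middle
      where yes pN-1 → pure (N , pN-1 , ¬pN)
    least-failure P N p0 ¬pN-1

  not-all : ∀ {A : Set} {P : A → Set} xs → ¬ (∀ r → r ∈ xs → P r) → ¬ ¬ (∃ λ r → r ∈ xs × ¬ P r)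
  not-all [] ¬all = ⊥-elim (¬all (λ r ()))
  not-all (x ∷ xs) ¬all = do
    yes px ← ¬¬-excluded-middle
      where no ¬px → pure (x , here refl , ¬px)
    (r , m , ¬pr) ← not-all xs (λ all → ¬all (λ { r (here refl) → px ; r (there m) → all r m }))
    pure (r , there m , ¬pr)

  not-implies : ∀ {A B : Set} → ¬ (A → B) → ¬ ¬ (A × ¬ B)
  not-implies ¬f = do
    yes a ← ¬¬-excluded-middle
      where no ¬a → ⊥-elim (¬f (λ a → ⊥-elim (¬a a)))
    pure (a , λ b → ¬f (λ _ → b))

  separating-transitions : ∀ {k k′ A B T U T′ U′} → T [] ≡ just (nt A) → U [] ≡ just (nt B) →
    ¬ T ∼[ suc k ] U → SimAt k′ T′ U′ (just (nt A)) (just (nt B)) →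
    ¬ ¬ (∃ λ r → ∃ λ r′ → r ∈ rules × Rule.lhs r ≡ A × r′ ∈ rules × Rule.lhs r′ ≡ B ×
                          ¬ next r T ∼[ k ] next r′ U × next r T′ ∼[ k′ ] next r′ U′)
  separating-transitions {k} {A = A} {B} {T} {U} e₁ e₂ ≁ (fwd , bwd) = do
    yes forth ← ¬¬-excluded-middle {A = Forth}
      where no ¬forth → do
              (r , mr , ¬match) ← not-all rules ¬forth
              (q , ¬r′) ← not-implies ¬match
              let (r′ , mr′ , q′ , act , s) = fwd r mr q
              pure (r , r′ , mr , q , mr′ , q′ , (λ s′ → ¬r′ (r′ , mr′ , q′ , act , s′)) , s)
    (r′ , mr′ , ¬match) ← not-all rules (λ back → ≁ (simAt-intro e₁ e₂ (forth , back)))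
    (q′ , ¬r) ← not-implies ¬match
    let (r , mr , q , act , s) = bwd r′ mr′ q′
    pure (r , r′ , mr , q , mr′ , q′ , (λ s′ → ¬r (r , mr , q , act , s′)) , s)
    where
    Forth : Set
    Forth = ∀ r → r ∈ rules → Rule.lhs r ≡ A → ∃[ r′ ] (r′ ∈ rules × Rule.lhs r′ ≡ B ×
              Rule.act r′ ≡ Rule.act r × next r T ∼[ k ] next r′ U)

  -- A list C covers t if every subterm of t equals a member of C; a cover
  -- bounds the presentation size without having to remove duplicates.
  Cover : Term → List Term → Set
  Cover t C = ∀ p → Def (t p) → ∃ λ u → u ∈ C × sub G t p ≈ u

  SizeAtMost : Term → ℕ → Set
  SizeAtMost t a = ∃ λ C → Cover t C × length C ≤ a

  sizeAtMost-weaken : ∀ {t a a′} → a ≤ a′ → SizeAtMost t a → SizeAtMost t a′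
  sizeAtMost-weaken le (C , cv , l) = C , cv , ≤-trans l le

  presSize→cover : ∀ t s → HasPresSize G t s → ∃ λ C → length C ≡ s × Cover t C
  presSize→cover t s (L , _ , _ , onto) =
    tabulate L , length-tabulate L , λ p dp → let (i , e) = onto p dp in L i , ∈-tabulate⁺ {f = L} i , e

  IsSubterm : Term → Term → Set
  IsSubterm t u = ∃ λ p → Def (t p) × u ≈ sub G t p

  Distinct : List Term → Set
  Distinct = AllPairs (λ u v → ¬ u ≈ v)

  Deduplicated : Term → List Term → Set
  Deduplicated t C = ∃ λ D → All (IsSubterm t) D × Distinct D ×
    (∀ u → u ∈ C → IsSubterm t u → ∃ λ v → v ∈ D × u ≈ v) × length D ≤ length C

  deduplicate : ∀ t C → ¬ ¬ Deduplicated t C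
  deduplicate t [] = pure ([] , All.[] , [] , (λ _ ()) , z≤n)
  deduplicate t (u ∷ C) = do
    (D , subD , distD , onto , lenD) ← deduplicate t C
    yes subu ← ¬¬-excluded-middle
      where no ¬subu → pure (D , subD , distD ,
                             (λ { v (here refl) subv → ⊥-elim (¬subu subv) ; v (there m) subv → onto v m subv }) ,
                             m≤n⇒m≤1+n lenD)
    no new ← ¬¬-excluded-middle {A = ∃ λ v → v ∈ D × u ≈ v}
      where yes old → pure (D , subD , distD ,
                             (λ { v (here refl) _ → old ; v (there m) subv → onto v m subv }) ,
                             m≤n⇒m≤1+n lenD)
    pure (u ∷ D , subu All.∷ subD , All.tabulate (λ {v} m e → new (v , m , e)) ∷ distD ,
          (λ { v (here refl) _ → u , here refl , ≈-refl
             ; v (there m) subv → let (w , mw , e) = onto v m subv in w , there mw , e }) ,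
          s≤s lenD)

  lookup-injective : ∀ D → Distinct D → ∀ i j → lookup D i ≈ lookup D j → i ≡ j
  lookup-injective (u ∷ D) dist Fin.zero Fin.zero e = refl
  lookup-injective (u ∷ D) (uD ∷ dist) Fin.zero (Fin.suc j) e = ⊥-elim (All.lookup uD (∈-lookup j) e)
  lookup-injective (u ∷ D) (uD ∷ dist) (Fin.suc i) Fin.zero e = ⊥-elim (All.lookup uD (∈-lookup i) (≈-sym e))
  lookup-injective (u ∷ D) (uD ∷ dist) (Fin.suc i) (Fin.suc j) e = cong Fin.suc (lookup-injective D dist i j e)

  cover→presSize : ∀ t C → Cover t C → ¬ ¬ (∃ λ s → s ≤ length C × HasPresSize G t s)
  cover→presSize t C cv = do
    (D , subD , distD , onto , lenD) ← deduplicate t C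
    pure (length D , lenD , lookup D , (λ i → All.lookup subD (∈-lookup i)) , lookup-injective D distD ,
          λ p dp → let (u , m , e) = cv p dp
                       (v , mv , e₂) = onto u m (p , dp , ≈-sym e)
                   in Any.index mv , ≈-trans e (≈-trans e₂ (≡-subst (v ≈_) (lookup-index mv) ≈-refl)))

  SubstPosition : Term → (ℕ → Term) → List ℕ → Set
  SubstPosition t σ p =
    (∃ λ q → Def (t q) × sub G (t ⟪ σ ⟫) p ≈ sub G t q ⟪ σ ⟫) ⊎
    (∃ λ q → ∃ λ l → ∃ λ r → t q ≡ just (var l) × Def (σ l r) × sub G (t ⟪ σ ⟫) p ≈ sub G (σ l) r)

  subst-position : ∀ t σ p → Def ((t ⟪ σ ⟫) p) → SubstPosition t σ p
  subst-position t σ p dp with t [] in eq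
  ... | just (var l) = inj₂ ([] , l , p , eq , def-cast (sym (subst-var t σ l eq p)) dp ,
                             λ y → subst-var t σ l eq (p ++ y))
  ... | nothing with () ← def-cast (sym (subst-undefined t σ eq p)) dp
  subst-position t σ [] dp | just (nt A) = inj₁ ([] , (nt A , eq) , ≈-refl)
  subst-position t σ (d ∷ p) dp | just (nt A)
    with subst-position (child t d) σ p (def-cast (sym (subst-nt-child t σ A eq d p)) dp)
  ... | inj₁ (q , dq , e) = inj₁ (d ∷ q , dq , λ y → trans (subst-nt-child t σ A eq d (p ++ y)) (e y))
  ... | inj₂ (q , l , r , eq′ , dr , e) =
    inj₂ (d ∷ q , l , r , eq′ , dr , λ y → trans (subst-nt-child t σ A eq d (p ++ y)) (e y))

  x-cover : ∀ i → Cover x[ i ] (x[ i ] ∷ [])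
  x-cover i [] dp = x[ i ] , here refl , ≈-refl

  subterms : FTerm nN arity → List Term
  subterms (fvar i) = embed G (fvar i) ∷ []
  subterms (fapp A cs) = embed G (fapp A cs) ∷ concat (tabulate (λ j → subterms (cs j)))

  embed-cover : ∀ f → Cover (embed G f) (subterms f)
  embed-cover (fvar i) [] dp = embed G (fvar i) , here refl , ≈-refl
  embed-cover (fapp A cs) [] dp = embed G (fapp A cs) , here refl , ≈-refl
  embed-cover (fapp A cs) (d ∷ p) dp with d <? arity A
  ... | no _ with () ← dp
  ... | yes h with embed-cover (cs (fromℕ< h)) p dp
  ...   | (u , m , e) = u , there (∈-concat⁺′ m (∈-tabulate⁺ {f = λ j → subterms (cs j)} (fromℕ< h))) , e

  rule-size : ∀ sinc → IsSInc G sinc → ∀ r → r ∈ rules → ¬ ¬ SizeAtMost (embed G (Rule.rhs r)) sinc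
  rule-size sinc isSInc r m = do
    (s , _ , hs) ← cover→presSize _ (subterms (Rule.rhs r)) (embed-cover (Rule.rhs r))
    let (C , lenC , cv) = presSize→cover _ s hs
    pure (C , cv , ≡-subst (_≤ sinc) (sym lenC) (proj₁ isSInc r m s hs))

  next-size : ∀ sinc r T a → SizeAtMost (embed G (Rule.rhs r)) sinc → SizeAtMost T a →
              SizeAtMost (next r T) (a + sinc)
  next-size sinc r T a (CR , cR , lR) (CT , cT , lT) = map (_⟪ child T ⟫) CR ++ CT , cover ,
    ≤-trans (≤-reflexive (trans (length-++ (map (_⟪ child T ⟫) CR)) (cong (_+ length CT) (length-map _ CR))))
            (≤-trans (+-mono-≤ lR lT) (≤-reflexive (+-comm sinc a)))
    where
    cover : Cover (next r T) (map (_⟪ child T ⟫) CR ++ CT)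
    cover p dp with subst-position (embed G (Rule.rhs r)) (child T) p dp
    ... | inj₁ (q , dq , e) = let (u , m , e′) = cR q dq in
      u ⟪ child T ⟫ , ∈-++⁺ˡ (∈-map⁺ (_⟪ child T ⟫) m) , ≈-trans e (subst-respˡ (child T) e′)
    ... | inj₂ (q , l , r′ , _ , dr , e) = let (u , m , e′) = cT (l ∷ r′) dr in
      u , ∈-++⁺ʳ (map (_⟪ child T ⟫) CR) m , ≈-trans e e′

  -- For a term H whose root is not x_i,
  -- `unfold t` is t[x_i ↦ H^ω] where H^ω = H[x_i ↦ H^ω] is the regular term
  -- obtained by unfolding H at x_i indefinitely; it is computed position-wise,
  -- each unfolding of x_i consuming the root step of H.
  module Unfold (H : Term) (i : ℕ) (H-term : IsTerm H) (H≢xᵢ : ¬ H [] ≡ just (var i)) where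
    mutual
      unfold : Term → Term
      unfold t p = unfoldAt (t []) t p

      unfoldAt : Maybe (Label nN) → Term → List ℕ → Maybe (Label nN)
      unfoldAt (just (var j)) t p = unfoldVar (j ≟ i) j p
      unfoldAt (just (nt A)) t [] = just (nt A)
      unfoldAt (just (nt A)) t (d ∷ p) = unfold (child t d) p
      unfoldAt nothing t p = nothing

      unfoldVar : ∀ {j} → Dec (j ≡ i) → ℕ → List ℕ → Maybe (Label nN)
      unfoldVar (yes _) j [] = H []
      unfoldVar (yes _) j (d ∷ p) = unfold (child H d) p
      unfoldVar (no _) j p = x[ j ] p

    unfold-nt-root : ∀ t A → t [] ≡ just (nt A) → unfold t [] ≡ just (nt A)
    unfold-nt-root t A eq rewrite eq = refl

    unfold-nt-child : ∀ t A → t [] ≡ just (nt A) → ∀ d → child (unfold t) d ≈ unfold (child t d)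
    unfold-nt-child t A eq d q rewrite eq = refl

    unfold-undefined : ∀ t → t [] ≡ nothing → ∀ p → unfold t p ≡ nothing
    unfold-undefined t eq p rewrite eq = refl

    unfold-xᵢ-root : ∀ t → t [] ≡ just (var i) → unfold t [] ≡ H []
    unfold-xᵢ-root t eq rewrite eq with i ≟ i
    ... | yes _ = refl
    ... | no i≢i = ⊥-elim (i≢i refl)

    unfold-xᵢ-child : ∀ t → t [] ≡ just (var i) → ∀ d → child (unfold t) d ≈ unfold (child H d)
    unfold-xᵢ-child t eq d q rewrite eq with i ≟ i
    ... | yes _ = refl
    ... | no i≢i = ⊥-elim (i≢i refl)

    unfold-xⱼ : ∀ t j → t [] ≡ just (var j) → ¬ j ≡ i → unfold t ≈ x[ j ]
    unfold-xⱼ t j eq j≢i p rewrite eq with j ≟ i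
    ... | yes j≡i = ⊥-elim (j≢i j≡i)
    ... | no _ = refl

    unfold-root : ∀ t → ¬ t [] ≡ just (var i) → unfold t [] ≡ t []
    unfold-root t ¬xᵢ with t [] in eq
    ... | just (nt A) = refl
    ... | nothing = refl
    ... | just (var j) with j ≟ i
    ...   | yes refl = ⊥-elim (¬xᵢ refl)
    ...   | no _ = refl

    unfold-H-child : ∀ d → child (unfold H) d ≈ unfold (child H d)
    unfold-H-child d q = byRoot (H []) refl
      where
      leafChild : IsLeaf (H []) → ∀ q → unfold (child H d) q ≡ nothing
      leafChild leaf = unfold-undefined (child H d) (leaf-child H (proj₂ H-term) leaf d)
      byRoot : ∀ m → H [] ≡ m → unfold H (d ∷ q) ≡ unfold (child H d) q
      byRoot (just (nt A)) eq = unfold-nt-child H A eq d q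
      byRoot (just (var j)) eq =
        trans (unfold-xⱼ H j eq (λ { refl → H≢xᵢ eq }) (d ∷ q)) (sym (leafChild (≡-subst IsLeaf (sym eq) tt) q))
      byRoot nothing eq = trans (unfold-undefined H eq (d ∷ q)) (sym (leafChild (≡-subst IsLeaf (sym eq) tt) q))

    ρ : ℕ → Term
    ρ l with l ≟ i
    ... | yes _ = unfold H
    ... | no _ = x[ l ]

    ρ-xᵢ : ρ i ≈ unfold H
    ρ-xᵢ p with i ≟ i
    ... | yes _ = refl
    ... | no i≢i = ⊥-elim (i≢i refl)

    ρ-xⱼ : ∀ j → ¬ j ≡ i → ρ j ≈ x[ j ]
    ρ-xⱼ j j≢i p with j ≟ i
    ... | yes j≡i = ⊥-elim (j≢i j≡i)
    ... | no _ = refl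

    unfold-subst : ∀ t → unfold t ≈ t ⟪ ρ ⟫
    unfold-subst t = byRoot (t []) refl
      where
      byRoot : ∀ m → t [] ≡ m → ∀ p → unfold t p ≡ (t ⟪ ρ ⟫) p
      byRoot (just (var j)) eq p with j ≟ i
      byRoot (just (var j)) eq [] | yes refl =
        trans (unfold-xᵢ-root t eq) (sym (trans (subst-var t ρ j eq []) (trans (ρ-xᵢ []) (unfold-root H H≢xᵢ))))
      byRoot (just (var j)) eq (d ∷ p) | yes refl =
        trans (unfold-xᵢ-child t eq d p) (sym (trans (subst-var t ρ j eq (d ∷ p)) (trans (ρ-xᵢ (d ∷ p)) (unfold-H-child d p))))
      ... | no j≢i = trans (unfold-xⱼ t j eq j≢i p) (sym (trans (subst-var t ρ j eq p) (ρ-xⱼ j j≢i p)))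
      byRoot (just (nt A)) eq [] = trans (unfold-nt-root t A eq) (sym (subst-nt-root t ρ A eq))
      byRoot (just (nt A)) eq (d ∷ p) =
        trans (unfold-nt-child t A eq d p) (trans (unfold-subst (child t d) p) (sym (subst-nt-child t ρ A eq d p)))
      byRoot nothing eq p = trans (unfold-undefined t eq p) (sym (subst-undefined t ρ eq p))

    unfold-root-defined : ∀ t → Def (t []) → Def (unfold t [])
    unfold-root-defined t (var j , eq) with j ≟ i
    ... | yes refl = def-cast (unfold-xᵢ-root t eq) (proj₁ H-term)
    ... | no j≢i = def-cast (unfold-xⱼ t j eq j≢i []) (var j , refl)
    unfold-root-defined t (nt A , eq) = def-cast (unfold-nt-root t A eq) (nt A , refl)

    unfold-rootOK : ∀ t → LocallyWF t → ¬ t [] ≡ just (var i) → ∀ d → ChildOK′ (unfold t []) (unfold t (d ∷ [])) d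
    unfold-rootOK t w ¬xᵢ d = byRoot (t []) refl
      where
      byRoot : ∀ m → t [] ≡ m → ChildOK′ (unfold t []) (unfold t (d ∷ [])) d
      byRoot (just (var j)) eq with j ≟ i
      ... | yes refl = ⊥-elim (¬xᵢ eq)
      ... | no j≢i = childOK-cast (unfold-xⱼ t j eq j≢i []) (unfold-xⱼ t j eq j≢i (d ∷ [])) refl
      byRoot nothing eq = childOK-cast (unfold-undefined t eq []) (unfold-undefined t eq (d ∷ [])) refl
      byRoot (just (nt A)) eq =
        childOK-cast (unfold-nt-root t A eq) (unfold-nt-child t A eq d []) (ntChild (t []) eq (w [] d))
        where
        ntChild : ∀ m → m ≡ just (nt A) → ChildOK′ m (t (d ∷ [])) d → ChildOK′ (just (nt A)) (unfold (child t d) []) d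
        ntChild _ refl (inj₁ (lt , dc)) = inj₁ (lt , unfold-root-defined (child t d) dc)
        ntChild _ refl (inj₂ (ge , e)) = inj₂ (ge , unfold-undefined (child t d) e [])

    unfold-LocallyWF : ∀ t → LocallyWF t → LocallyWF (unfold t)
    unfold-LocallyWF t w p d = byRoot (t []) refl p
      where
      byRoot : ∀ m → t [] ≡ m → ∀ p → ChildOK′ (unfold t p) (unfold t (p ++ (d ∷ []))) d
      byRoot (just (var j)) eq p with j ≟ i
      byRoot (just (var j)) eq [] | yes refl =
        childOK-cast (trans (unfold-xᵢ-root t eq) (sym (unfold-root H H≢xᵢ)))
                     (trans (unfold-xᵢ-child t eq d []) (sym (unfold-H-child d [])))
                     (unfold-rootOK H (proj₂ H-term) H≢xᵢ d)
      byRoot (just (var j)) eq (x ∷ p) | yes refl =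
        childOK-cast (unfold-xᵢ-child t eq x p) (unfold-xᵢ-child t eq x (p ++ (d ∷ [])))
                     (unfold-LocallyWF (child H x) (LocallyWF-child H x (proj₂ H-term)) p d)
      ... | no j≢i = childOK-cast (unfold-xⱼ t j eq j≢i p) (unfold-xⱼ t j eq j≢i (p ++ (d ∷ []))) (proj₂ (x-IsTerm j) p d)
      byRoot (just (nt A)) eq [] = unfold-rootOK t w (λ e → ntVar (trans (sym eq) e)) d
        where
        ntVar : ¬ just (nt {nN} A) ≡ just (var i)
        ntVar ()
      byRoot (just (nt A)) eq (x ∷ p) =
        childOK-cast (unfold-nt-child t A eq x p) (unfold-nt-child t A eq x (p ++ (d ∷ [])))
                     (unfold-LocallyWF (child t x) (LocallyWF-child t x w) p d)
      byRoot nothing eq p = childOK-cast (unfold-undefined t eq p) (unfold-undefined t eq (p ++ (d ∷ []))) refl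

    unfold-IsTerm : ∀ t → IsTerm t → IsTerm (unfold t)
    unfold-IsTerm t w = unfold-root-defined t (proj₁ w) , unfold-LocallyWF t (proj₂ w)

    unfold-resp : ∀ {t t′} → t ≈ t′ → unfold t ≈ unfold t′
    unfold-resp e p = trans (unfold-subst _ p) (trans (subst-respˡ ρ e p) (sym (unfold-subst _ p)))

    UnfoldPosition : Term → List ℕ → Set
    UnfoldPosition t p = (∃ λ q → Def (t q) × sub G (unfold t) p ≈ unfold (sub G t q))
                       ⊎ (∃ λ q → Def (H q) × sub G (unfold t) p ≈ unfold (sub G H q))

    unfold-position : ∀ t p → Def (unfold t p) → UnfoldPosition t p
    unfold-position t p dp = byRoot (t []) refl p dp
      where
      undefined : ∀ {A : Set} {m} → m ≡ nothing → Def m → A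
      undefined refl (_ , ())
      byRoot : ∀ m → t [] ≡ m → ∀ p → Def (unfold t p) → UnfoldPosition t p
      byRoot (just l) eq [] dp = inj₁ ([] , (l , eq) , ≈-refl)
      byRoot nothing eq p dp = undefined (unfold-undefined t eq p) dp
      byRoot (just (nt A)) eq (d ∷ p) dp
        with unfold-position (child t d) p (def-cast (sym (unfold-nt-child t A eq d p)) dp)
      ... | inj₁ (q , dq , e) = inj₁ (d ∷ q , dq , λ y → trans (unfold-nt-child t A eq d (p ++ y)) (e y))
      ... | inj₂ (q , dq , e) = inj₂ (q , dq , λ y → trans (unfold-nt-child t A eq d (p ++ y)) (e y))
      byRoot (just (var j)) eq (d ∷ p) dp with j ≟ i
      ... | no j≢i = undefined (unfold-xⱼ t j eq j≢i (d ∷ p)) dp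
      ... | yes refl with unfold-position (child H d) p (def-cast (sym (unfold-xᵢ-child t eq d p)) dp)
      ...   | inj₁ (q , dq , e) = inj₂ (d ∷ q , dq , λ y → trans (unfold-xᵢ-child t eq d (p ++ y)) (e y))
      ...   | inj₂ (q , dq , e) = inj₂ (q , dq , λ y → trans (unfold-xᵢ-child t eq d (p ++ y)) (e y))

    unfold-size : ∀ t a h → SizeAtMost t a → SizeAtMost H h → SizeAtMost (unfold t) (a + h)
    unfold-size t a h (CT , cT , lT) (CH , cH , lH) = map unfold CT ++ map unfold CH , cover ,
      ≤-trans (≤-reflexive (trans (length-++ (map unfold CT)) (cong₂ _+_ (length-map unfold CT) (length-map unfold CH))))
              (+-mono-≤ lT lH)
      where
      cover : Cover (unfold t) (map unfold CT ++ map unfold CH)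
      cover p dp with unfold-position t p dp
      ... | inj₁ (q , dq , e) = let (u , m , e′) = cT q dq in
        unfold u , ∈-++⁺ˡ (∈-map⁺ unfold m) , ≈-trans e (unfold-resp e′)
      ... | inj₂ (q , dq , e) = let (u , m , e′) = cH q dq in
        unfold u , ∈-++⁺ʳ (map unfold CT) (∈-map⁺ unfold m) , ≈-trans e (unfold-resp e′)

  -- A witness that x_i can be eliminated from σ up to level K: σ(x_i) ∼_K H⟪σ⟫
  -- for a term H of size ≤ h which is not x_i itself.
  record Witness (σ : ℕ → Term) (K h : ℕ) : Set where
    constructor witness
    field
      i      : ℕ
      H      : Term
      H-term : IsTerm H
      H≢x    : ¬ H [] ≡ just (var i)
      H-sim  : σ i ∼[ K ] H ⟪ σ ⟫
      H-size : SizeAtMost H h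

  witness-weaken : ∀ {σ K h h′} → h ≤ h′ → Witness σ K h → Witness σ K h′
  witness-weaken le (witness i H wH ≢ s sH) = witness i H wH ≢ s (sizeAtMost-weaken le sH)

  -- If E ≁_k F but E⟪σ⟫ ∼_{k+m} F⟪σ⟫, follow transitions
  -- that separate E from F: after d < k steps one side is a variable x_i and
  -- the other a term H ≠ x_i, yielding σ(x_i) ∼_{k+m-d} H⟪σ⟫.  Each step
  -- adds at most SInc to the size.
  module Mismatch (σ : ℕ → Term) (σ-terms : ∀ l → IsTerm (σ l)) (sinc : ℕ) (isSInc : IsSInc G sinc) where

    Found : ℕ → ℕ → ℕ → Set
    Found k m a = ∃ λ d → ∃ λ K → d < k × k + m ≤ K + d × Witness σ K (a + d * sinc)

    mismatch : ∀ k m E F a → IsTerm E → IsTerm F → SizeAtMost E a → SizeAtMost F a →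
               ¬ E ∼[ k ] F → E ⟪ σ ⟫ ∼[ k + m ] F ⟪ σ ⟫ → ¬ ¬ Found k m a
    mismatch zero m E F a wE wF sE sF ≁ ∼σ = ⊥-elim (≁ tt)
    mismatch (suc k) m E F a wE wF sE sF ≁ ∼σ = byRoots (proj₁ wE) (proj₁ wF)
      where
      found-at-root : ∀ i H → IsTerm H → ¬ H [] ≡ just (var i) → σ i ∼[ suc k + m ] H ⟪ σ ⟫ → SizeAtMost H a →
              Found (suc k) m a
      found-at-root i H wH ≢ s sH = 0 , suc k + m , s≤s z≤n , ≤-reflexive (sym (+-identityʳ _)) ,
                            witness i H wH ≢ s (sizeAtMost-weaken (m≤m+n a 0) sH)
      var-root : ∀ {T i} → T [] ≡ just (var i) → T ⟪ σ ⟫ ≈ σ i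
      var-root {T} {i} = subst-var T σ i
      byRoots : Def (E []) → Def (F []) → ¬ ¬ Found (suc k) m a
      byRoots (var i , e₁) (var j , e₂) with i ≟ j
      ... | yes i≡j = ⊥-elim (≁ (simAt-intro e₁ e₂ i≡j))
      ... | no i≢j = pure (found-at-root i F wF (λ e → i≢j (sym (var-injective (trans (sym e₂) e))))
                                  (sim-resp (suc k + m) ∼σ (var-root e₁) ≈-refl) sF)
      byRoots (var i , e₁) (nt B , e₂) = pure (found-at-root i F wF (λ e → ntVar (trans (sym e₂) e))
                                                (sim-resp (suc k + m) ∼σ (var-root e₁) ≈-refl) sF)
        where
        ntVar : ¬ just (nt {nN} B) ≡ just (var i)
        ntVar ()
      byRoots (nt A , e₁) (var j , e₂) = pure (found-at-root j E wE (λ e → ntVar (trans (sym e₁) e))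
                                                (sim-sym (suc k + m) (sim-resp (suc k + m) ∼σ ≈-refl (var-root e₂))) sE)
        where
        ntVar : ¬ just (nt {nN} A) ≡ just (var j)
        ntVar ()
      byRoots (nt A , e₁) (nt B , e₂) = do
        (r , r′ , mr , q , mr′ , q′ , ≁′ , ∼′) ←
          separating-transitions {k′ = k + m} {T′ = E ⟪ σ ⟫} {U′ = F ⟪ σ ⟫} e₁ e₂ ≁
            (simAt-elim (subst-nt-root E σ A e₁) (subst-nt-root F σ B e₂) ∼σ)
        sr ← rule-size sinc isSInc r mr
        sr′ ← rule-size sinc isSInc r′ mr′
        (d , K , d<k , K+d≥ , w) ←
          mismatch k m (next r E) (next r′ F) (a + sinc) (next-IsTerm r E A wE e₁ mr q) (next-IsTerm r′ F B wF e₂ mr′ q′)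
            (next-size sinc r E a sr sE) (next-size sinc r′ F a sr′ sF) ≁′
            (sim-resp (k + m) ∼′ (next-subst r E σ A e₁) (next-subst r′ F σ B e₂))
        pure (suc d , K , s≤s d<k , ≤-trans (s≤s K+d≥) (≤-reflexive (sym (+-suc K d))) ,
              witness-weaken (≤-reflexive (+-assoc a sinc (d * sinc))) w)

  SupportIn : (ℕ → Term) → List ℕ → Set
  SupportIn σ S = ∀ l → l ∉ S → σ l ≈ x[ l ]

  -- Given a witness σ(x_i) ∼_K H⟪σ⟫, let σ′ agree with σ
  -- except σ′(x_i) = x_i.  Then t⟪σ⟫ ∼_K t[x_i ↦ H^ω]⟪σ′⟫ for every term t, so
  -- the support shrinks while all equivalences below level K are kept.
  module Eliminate (σ : ℕ → Term) (σ-terms : ∀ l → IsTerm (σ l)) {K h : ℕ} (w : Witness σ K h) where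
    open Witness w
    open Unfold H i H-term H≢x public

    σ′ : ℕ → Term
    σ′ l with l ≟ i
    ... | yes _ = x[ i ]
    ... | no _ = σ l

    σ′-xⱼ : ∀ l → ¬ l ≡ i → σ′ l ≈ σ l
    σ′-xⱼ l l≢i p with l ≟ i
    ... | yes l≡i = ⊥-elim (l≢i l≡i)
    ... | no _ = refl

    σ′-xᵢ : σ′ i ≈ x[ i ]
    σ′-xᵢ p with i ≟ i
    ... | yes _ = refl
    ... | no i≢i = ⊥-elim (i≢i refl)

    σ′-terms : ∀ l → IsTerm (σ′ l)
    σ′-terms l with l ≟ i
    ... | yes _ = x-IsTerm i
    ... | no _ = σ-terms l

    τ : ℕ → Term
    τ l = ρ l ⟪ σ′ ⟫

    τ-xᵢ : τ i ≈ unfold H ⟪ σ′ ⟫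
    τ-xᵢ = subst-respˡ σ′ ρ-xᵢ

    τ-xⱼ : ∀ k l → ¬ l ≡ i → σ l ∼[ k ] τ l
    τ-xⱼ k l l≢i = sim-resp k (sim-refl k (σ l) (σ-terms l)) ≈-refl
      (≈-sym (≈-trans (subst-respˡ σ′ (ρ-xⱼ l l≢i)) (≈-trans (subst-var x[ l ] σ′ l refl) (σ′-xⱼ l l≢i))))

    unfold-σ′ : ∀ t → unfold t ⟪ σ′ ⟫ ≈ t ⟪ τ ⟫
    unfold-σ′ t = ≈-trans (subst-respˡ σ′ (unfold-subst t)) (subst-comp t ρ σ′)

    -- σ(x_i) ∼_k H^ω⟪σ′⟫ for k ≤ K, by induction on k: H is not x_i, so the
    -- guarded congruence gains the level lost at x_i.  Consequently σ ∼_k τ.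
    mutual
      fixpoint-sim : ∀ k → k ≤ K → σ i ∼[ k ] unfold H ⟪ σ′ ⟫
      fixpoint-sim zero _ = tt
      fixpoint-sim (suc k) k<K = sim-trans (suc k) (sim-≤ k<K H-sim)
        (sim-resp (suc k) (sim-cong-guarded k H σ τ i H-term (σ∼τ k (≤-trans (n≤1+n k) k<K)) (λ l → τ-xⱼ (suc k) l) H≢x)
                  ≈-refl (≈-sym (unfold-σ′ H)))

      σ∼τ : ∀ k → k ≤ K → ∀ l → σ l ∼[ k ] τ l
      σ∼τ k k≤K l = byCase (l ≟ i)
        where
        byCase : Dec (l ≡ i) → σ l ∼[ k ] τ l
        byCase (yes refl) = sim-resp k (fixpoint-sim k k≤K) ≈-refl (≈-sym τ-xᵢ)
        byCase (no l≢i) = τ-xⱼ k l l≢i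

    eliminate : ∀ t → IsTerm t → t ⟪ σ ⟫ ∼[ K ] unfold t ⟪ σ′ ⟫
    eliminate t wt = sim-resp K (sim-cong K t σ τ wt (σ∼τ K ≤-refl)) ≈-refl (≈-sym (unfold-σ′ t))

    eliminate-level : ∀ {E F e} → IsTerm E → IsTerm F → e < K → EqLIs G (E ⟪ σ ⟫) (F ⟪ σ ⟫) e →
                      EqLIs G (unfold E ⟪ σ′ ⟫) (unfold F ⟪ σ′ ⟫) e
    eliminate-level {E} {F} {e} wE wF e<K (∼ₑ , ≁ₑ₊₁) = ∼ , ≁
      where
      ∼ : unfold E ⟪ σ′ ⟫ ∼[ e ] unfold F ⟪ σ′ ⟫
      ∼ = sim-trans e (sim-sym e (sim-≤ (<⇒≤ e<K) (eliminate E wE)))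
            (sim-trans e ∼ₑ (sim-≤ (<⇒≤ e<K) (eliminate F wF)))
      ≁ : ¬ unfold E ⟪ σ′ ⟫ ∼[ suc e ] unfold F ⟪ σ′ ⟫
      ≁ s = ≁ₑ₊₁ (sim-trans (suc e) (sim-≤ e<K (eliminate E wE))
              (sim-trans (suc e) s (sim-sym (suc e) (sim-≤ e<K (eliminate F wF)))))

    support-shrinks : ∀ {n} → (supp : SuppBound G (suc n) σ) → i ∈ proj₁ supp → SuppBound G n σ′
    support-shrinks (S , |S|≤ , S-supports) i∈S =
      filter keep? S ,
      s≤s⁻¹ (≤-trans (filter-notAll keep? S (Any.map (λ { refl l≢l → l≢l refl }) i∈S)) |S|≤) ,
      λ l l∉S′ → byCase l l∉S′ (l ≟ i)
      where
      keep? : (l : ℕ) → Dec (¬ l ≡ i)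
      keep? l = ¬? (l ≟ i)
      byCase : ∀ l → l ∉ filter keep? S → Dec (l ≡ i) → σ′ l ≈ x[ l ]
      byCase l _ (yes refl) = σ′-xᵢ
      byCase l l∉S′ (no l≢i) = ≈-trans (σ′-xⱼ l l≢i) (S-supports l (λ l∈S → l∉S′ (∈-filter⁺ keep? l∈S l≢i)))

  empty-support : ∀ {σ i} → (supp : SuppBound G 0 σ) → ¬ i ∈ proj₁ supp
  empty-support ([] , _ , _) ()

  -- A witness can be chosen with its variable in the support: if σ(x_i) = x_i
  -- then H⟪σ⟫ ∼_1 x_i forces H = x_j with σ(x_j) = x_i ≠ x_j, and x_j serves
  -- as the witness variable with H = x_i.
  witness-in-support : ∀ σ S → SupportIn σ S → ∀ {K h} → 1 ≤ K → 1 ≤ h → Witness σ K h →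
                       ∃ λ (w : Witness σ K h) → Witness.i w ∈ S
  witness-in-support σ S supp {K} K≥1 h≥1 w@(witness i H H-term H≢x H-sim H-size) with i ∈? S
  ... | yes i∈S = w , i∈S
  ... | no i∉S with proj₁ H-term
  ...   | nt A , eq = ⊥-elim (simAt-elim {a′ = just (var i)} refl (subst-nt-root H σ A eq) xᵢ∼Hσ)
    where
    xᵢ∼Hσ : x[ i ] ∼[ 1 ] H ⟪ σ ⟫
    xᵢ∼Hσ = sim-resp 1 (sim-≤ K≥1 H-sim) (supp i i∉S) ≈-refl
  ...   | var j , eq with j ∈? S
  ...     | yes j∈S = witness j x[ i ] (x-IsTerm i) (λ e → i≢j (var-injective e))
                        (sim-resp K (sim-sym K H-sim) (subst-var H σ j eq) (≈-sym (subst-var x[ i ] σ i refl)))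
                        (x[ i ] ∷ [] , x-cover i , h≥1) , j∈S
    where
    i≢j : ¬ i ≡ j
    i≢j refl = H≢x eq
  ...     | no j∉S = ⊥-elim (i≢j (sim-resp 1 (sim-≤ K≥1 H-sim) (supp i i∉S)
                                    (≈-trans (subst-var H σ j eq) (supp j j∉S))))
    where
    i≢j : ¬ i ≡ j
    i≢j refl = H≢x eq

  -- An eqlevel-decreasing (n,g)-sequence of length L, indexed from 0 and with
  -- the sizes of E_j, F_j given by covers.
  record Sequence (n : ℕ) (g : ℕ → ℕ) (L : ℕ) : Set where
    field
      σ          : ℕ → Term
      σ-terms    : ∀ l → IsTerm (σ l)
      support    : SuppBound G n σ
      E F        : ℕ → Term
      level      : ℕ → ℕ
      terms      : ∀ j → j < L → IsTerm (E j) × IsTerm (F j)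
      sizes      : ∀ j → j < L → ∃ λ a → ∃ λ b → SizeAtMost (E j) a × SizeAtMost (F j) b × a + b ≤ g (suc j)
      levels     : ∀ j → j < L → EqLIs G (E j ⟪ σ ⟫) (F j ⟪ σ ⟫) (level j)
      decreasing : ∀ i j → i < j → j < L → level j < level i

  level-drop : ∀ (e : ℕ → ℕ) L → (∀ i j → i < j → j < L → e j < e i) → ∀ j → j < L → j + e j ≤ e 0
  level-drop e L dec zero j<L = ≤-refl
  level-drop e L dec (suc j) j<L = begin
    suc j + e (suc j)  ≡⟨ sym (+-suc j (e (suc j))) ⟩
    j + suc (e (suc j)) ≤⟨ +-monoʳ-≤ j (dec j (suc j) (n<1+n j) j<L) ⟩
    j + e j            ≤⟨ level-drop e L dec j (<⇒≤ j<L) ⟩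
    e 0                ∎
    where open ≤-Reasoning

  -- The arithmetic behind "K exceeds the levels after the prefix": the
  -- witness loses d ≤ B levels while the level drops by more than B.
  below-witness-level : ∀ {x d B j e₀ K} → d ≤ B → (suc B + j) + x ≤ e₀ → e₀ ≤ K + d → x < K
  below-witness-level {x} {d} {B} {j} {e₀} {K} d≤B drop e₀≤ = +-cancelʳ-≤ d (suc x) K (begin
    suc x + d        ≤⟨ +-monoʳ-≤ (suc x) d≤B ⟩
    suc (x + B)      ≡⟨ cong suc (+-comm x B) ⟩
    suc B + x        ≤⟨ +-monoˡ-≤ x (m≤m+n (suc B) j) ⟩
    (suc B + j) + x  ≤⟨ drop ⟩
    e₀               ≤⟨ e₀≤ ⟩
    K + d            ∎)
    where open ≤-Reasoning

  add-twice : ∀ a b h → (a + h) + (b + h) ≡ (a + b) + 2 * h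
  add-twice = solve 3 (λ a b h → (a :+ h) :+ (b :+ h) := (a :+ b) :+ (con 2 :* h)) refl
    where open +-*-Solver

  module Bound (bmel : ℕ → ℕ) (isBMEL : ∀ b → IsBMEL G b (bmel b)) (sinc : ℕ) (isSInc : IsSInc G sinc) where

    prefix : (ℕ → ℕ) → ℕ
    prefix g = 1 + bmel (g 1)

    witnessSize : (ℕ → ℕ) → ℕ
    witnessSize g = g 1 + bmel (g 1) * sinc

    shift : (ℕ → ℕ) → ℕ → ℕ
    shift g j = g (prefix g + j) + 2 * witnessSize g

    small-pair-level : ∀ {E F a b B} → IsTerm E → IsTerm F → SizeAtMost E a → SizeAtMost F b → a + b ≤ B →
                       ∀ N → ¬ E ∼[ N ] F → ¬ ¬ (∃ λ k → k ≤ bmel B × ¬ E ∼[ suc k ] F)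
    small-pair-level {E} {F} {B = B} wE wF (CE , cE , lE) (CF , cF , lF) a+b≤ N ≁ = do
      (k , ∼ₖ , ≁ₖ₊₁) ← least-failure (λ k → E ∼[ k ] F) N tt ≁
      (s₁ , s₁≤ , hE) ← cover→presSize E CE cE
      (s₂ , s₂≤ , hF) ← cover→presSize F CF cF
      pure (k , proj₁ (isBMEL B) E F k (wE , s₁ , hE) (wF , s₂ , hF)
                  (s₁ , s₂ , hE , hF , ≤-trans (+-mono-≤ (≤-trans s₁≤ lE) (≤-trans s₂≤ lF)) a+b≤)
                  (λ equiv → ≁ₖ₊₁ (equiv (suc k))) (∼ₖ , ≁ₖ₊₁) ,
            ≁ₖ₊₁)

    -- If the sequence is longer than the prefix, some variable of
    -- σ can be eliminated up to a level K above all levels after the prefix: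
    -- E_0 ≁ F_0 is witnessed at a level k ≤ BMEL_{g(1)} < level 0, so the
    -- mismatch lemma gives a witness at K ≥ level 0 − d with d < k.
    long-sequence-witness : ∀ {n g L} (seq : Sequence n g L) → 1 ≤ g 1 → prefix g < L → let open Sequence seq in
      ¬ ¬ (∃ λ K → (∀ j → prefix g + j < L → level (prefix g + j) < K) ×
                   Σ (Witness σ K (witnessSize g)) λ w → Witness.i w ∈ proj₁ support)
    long-sequence-witness {n} {g} {L} seq g₁≥1 c<L = do
      (k , k≤bmel , E₀≁F₀) ← small-pair-level wE wF sE sF a+b≤ (suc (level 0)) ¬E₀∼F₀
      let level₀-split : suc k + (level 0 ∸ suc k) ≡ level 0
          level₀-split = m+[n∸m]≡n (≤-trans (s≤s k≤bmel) (≤-trans (m≤m+n (prefix g) _) (level-drop′ (prefix g) c<L)))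
      (d , K , d<k , K+d≥ , w) ← Mismatch.mismatch σ σ-terms sinc isSInc (suc k) (level 0 ∸ suc k) (E 0) (F 0) (g 1)
        wE wF (sizeAtMost-weaken (≤-trans (m≤m+n a b) a+b≤) sE) (sizeAtMost-weaken (≤-trans (m≤n+m b a) a+b≤) sF) E₀≁F₀
        (≡-subst (λ z → E 0 ⟪ σ ⟫ ∼[ z ] F 0 ⟪ σ ⟫) (sym level₀-split) (proj₁ (levels 0 0<L)))
      let d≤bmel = ≤-trans (s≤s⁻¹ d<k) k≤bmel
          above : ∀ j → prefix g + j < L → level (prefix g + j) < K
          above j lt = below-witness-level d≤bmel (level-drop′ (prefix g + j) lt)
                         (≤-trans (≤-reflexive (sym level₀-split)) K+d≥)
          K≥1 = ≤-trans (s≤s z≤n) (above 0 (≤-trans (≤-reflexive (cong suc (+-identityʳ (prefix g)))) c<L))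
      pure (K , above , witness-in-support σ (proj₁ support) (proj₂ (proj₂ support)) K≥1
                          (≤-trans g₁≥1 (m≤m+n _ _)) (witness-weaken (+-monoʳ-≤ (g 1) (*-monoˡ-≤ sinc d≤bmel)) w))
      where
      open Sequence seq
      level-drop′ : ∀ j → j < L → j + level j ≤ level 0
      level-drop′ = level-drop level L decreasing
      0<L : 0 < L
      0<L = ≤-trans (s≤s z≤n) c<L
      wE : IsTerm (E 0)
      wE = proj₁ (terms 0 0<L)
      wF : IsTerm (F 0)
      wF = proj₂ (terms 0 0<L)
      a b : ℕ
      a = proj₁ (sizes 0 0<L)
      b = proj₁ (proj₂ (sizes 0 0<L))
      sE : SizeAtMost (E 0) a
      sE = proj₁ (proj₂ (proj₂ (sizes 0 0<L)))
      sF : SizeAtMost (F 0) b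
      sF = proj₁ (proj₂ (proj₂ (proj₂ (sizes 0 0<L))))
      a+b≤ : a + b ≤ g 1
      a+b≤ = proj₂ (proj₂ (proj₂ (proj₂ (sizes 0 0<L))))
      ¬E₀∼F₀ : ¬ E 0 ∼[ suc (level 0) ] F 0
      ¬E₀∼F₀ s = proj₂ (levels 0 0<L) (sim-subst (suc (level 0)) (E 0) (F 0) σ wE wF σ-terms s)

    -- After eliminating x_i, the sequence from the prefix on is an
    -- eqlevel-decreasing (n, g′)-sequence with g′ = shift g: levels are kept
    -- because K exceeds them, and each term grows by at most the size of H.
    tail-sequence : ∀ {n g L K} (seq : Sequence (suc n) g L) → prefix g ≤ L →
      let open Sequence seq in ∀ (w : Witness σ K (witnessSize g)) → Witness.i w ∈ proj₁ support →
      (∀ j → prefix g + j < L → level (prefix g + j) < K) → Sequence n (shift g) (L ∸ prefix g)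
    tail-sequence {n} {g} {L} {K} seq c≤L w i∈S above = record
      { σ = σ′ ; σ-terms = σ′-terms ; support = support-shrinks support i∈S
      ; E = λ j → unfold (E (c + j)) ; F = λ j → unfold (F (c + j)) ; level = λ j → level (c + j)
      ; terms = λ j lt → unfold-IsTerm _ (proj₁ (terms (c + j) (shifted j lt))) ,
                         unfold-IsTerm _ (proj₂ (terms (c + j) (shifted j lt)))
      ; sizes = sizes′
      ; levels = λ j lt → let x<L = shifted j lt in
          eliminate-level (proj₁ (terms _ x<L)) (proj₂ (terms _ x<L)) (above j x<L) (levels _ x<L)
      ; decreasing = λ i j i<j j<L → decreasing (c + i) (c + j) (+-monoʳ-< c i<j) (shifted j j<L)
      }
      where
      open Sequence seq
      open Eliminate σ σ-terms w
      c : ℕ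
      c = prefix g
      shifted : ∀ j → j < L ∸ c → c + j < L
      shifted j lt = begin-strict
        c + j        <⟨ +-monoʳ-< c lt ⟩
        c + (L ∸ c)  ≡⟨ m+[n∸m]≡n c≤L ⟩
        L            ∎
        where open ≤-Reasoning
      sizes′ : ∀ j → j < L ∸ c → ∃ λ a → ∃ λ b → SizeAtMost (unfold (E (c + j))) a ×
               SizeAtMost (unfold (F (c + j))) b × a + b ≤ shift g (suc j)
      sizes′ j lt with sizes (c + j) (shifted j lt)
      ... | (a , b , sE , sF , a+b≤) = a + witnessSize g , b + witnessSize g ,
            unfold-size _ a _ sE (Witness.H-size w) , unfold-size _ b _ sF (Witness.H-size w) ,
            (begin
              (a + h) + (b + h)   ≡⟨ add-twice a b h ⟩
              (a + b) + 2 * h     ≤⟨ +-monoˡ-≤ (2 * h) a+b≤ ⟩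
              g (suc (c + j)) + 2 * h ≡⟨ cong (λ z → g z + 2 * h) (sym (+-suc c j)) ⟩
              shift g (suc j)     ∎)
        where
        open ≤-Reasoning
        h : ℕ
        h = witnessSize g

    bound : ∀ n g L → 1 ≤ g 1 → Sequence n g L → ¬ ¬ (L ≤ ell bmel sinc n g)
    bound zero g L g₁≥1 seq with L ≤? prefix g
    ... | yes L≤c = pure L≤c
    ... | no L≰c = do
      (_ , _ , _ , xᵢ∈S) ← long-sequence-witness seq g₁≥1 (≰⇒> L≰c)
      ⊥-elim (empty-support (Sequence.support seq) xᵢ∈S)
    bound (suc n) g L g₁≥1 seq with L ≤? prefix g
    ... | yes L≤c = pure (≤-trans L≤c (m≤m+n (prefix g) _))
    ... | no L≰c = do
      (K , above , w , xᵢ∈S) ← long-sequence-witness seq g₁≥1 c<L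
      L∸c≤ell ← bound n (shift g) (L ∸ prefix g) g′₁≥1 (tail-sequence seq (<⇒≤ c<L) w xᵢ∈S above)
      pure (begin
        L                          ≡⟨ sym (m+[n∸m]≡n (<⇒≤ c<L)) ⟩
        prefix g + (L ∸ prefix g)  ≤⟨ +-monoʳ-≤ (prefix g) L∸c≤ell ⟩
        ell bmel sinc (suc n) g    ∎)
      where
      open ≤-Reasoning
      c<L : prefix g < L
      c<L = ≰⇒> L≰c
      g′₁≥1 : 1 ≤ shift g 1
      g′₁≥1 = ≤-trans g₁≥1 (≤-trans (m≤m+n (g 1) (bmel (g 1) * sinc))
                (≤-trans (m≤m+n (witnessSize g) (witnessSize g + 0)) (m≤n+m (2 * witnessSize g) (g (prefix g + 1)))))

  extend : ∀ {A : Set} {L} → A → (Fin L → A) → ℕ → A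
  extend {L = L} default f j with j <? L
  ... | yes j<L = f (fromℕ< j<L)
  ... | no _ = default

  extend-< : ∀ {A : Set} {L} (default : A) (f : Fin L → A) j (j<L : j < L) → extend default f j ≡ f (fromℕ< j<L)
  extend-< {L = L} default f j j<L with j <? L
  ... | yes j<L′ = cong (λ z → f (fromℕ< z)) (<-irrelevant j<L′ j<L)
  ... | no j≮L = ⊥-elim (j≮L j<L)

  to-sequence : ∀ n g L (V : Fin L → Term × Term) → EqlevelDecreasing G L V → IsNGSeq G n g L V → Sequence n g L
  to-sequence n g L V (e , eqL , decr) (σ , σ-terms , supp , E , F , EF-terms , EF-size , V≈) = record
    { σ = σ ; σ-terms = σ-terms ; support = supp
    ; E = E′ ; F = F′ ; level = e′
    ; terms = terms′ ; sizes = sizes′ ; levels = levels′ ; decreasing = decreasing′ }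
    where
    E′ F′ : ℕ → Term
    E′ = extend x[ 0 ] E
    F′ = extend x[ 0 ] F
    e′ : ℕ → ℕ
    e′ = extend 0 e
    terms′ : ∀ j → j < L → IsTerm (E′ j) × IsTerm (F′ j)
    terms′ j j<L rewrite extend-< x[ 0 ] E j j<L | extend-< x[ 0 ] F j j<L = EF-terms (fromℕ< j<L)
    sizes′ : ∀ j → j < L → ∃ λ a → ∃ λ b → SizeAtMost (E′ j) a × SizeAtMost (F′ j) b × a + b ≤ g (suc j)
    sizes′ j j<L rewrite extend-< x[ 0 ] E j j<L | extend-< x[ 0 ] F j j<L with EF-size (fromℕ< j<L)
    ... | (s , s′ , hE , hF , le) =
      let (CE , lE , cE) = presSize→cover _ s hE
          (CF , lF , cF) = presSize→cover _ s′ hF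
      in s , s′ , (CE , cE , ≤-reflexive lE) , (CF , cF , ≤-reflexive lF) ,
         ≤-trans le (≤-reflexive (cong (λ z → g (suc z)) (toℕ-fromℕ< j<L)))
    levels′ : ∀ j → j < L → EqLIs G (E′ j ⟪ σ ⟫) (F′ j ⟪ σ ⟫) (e′ j)
    levels′ j j<L rewrite extend-< x[ 0 ] E j j<L | extend-< x[ 0 ] F j j<L | extend-< 0 e j j<L =
      let (s , ¬s) = eqL (fromℕ< j<L)
          (V₁≈ , V₂≈) = V≈ (fromℕ< j<L)
      in sim-resp (e (fromℕ< j<L)) s V₁≈ V₂≈ ,
         λ s′ → ¬s (sim-resp (suc (e (fromℕ< j<L))) s′ (≈-sym V₁≈) (≈-sym V₂≈))
    decreasing′ : ∀ i j → i < j → j < L → e′ j < e′ i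
    decreasing′ i j i<j j<L rewrite extend-< 0 e j j<L | extend-< 0 e i (<-trans i<j j<L) =
      decr (fromℕ< (<-trans i<j j<L)) (fromℕ< j<L)
           (≡-subst₂ _<_ (sym (toℕ-fromℕ< _)) (sym (toℕ-fromℕ< j<L)) i<j)

-- Lemma 2: every eqlevel-decreasing (n,g)-sequence has length at most ℓ_{n,g}.
lemma2 : (G : Grammar) (n : ℕ) (g : ℕ → ℕ)
    → (∀ j → 1 ≤ j → 1 ≤ g j)
    → (∀ i j → 1 ≤ i → i ≤ j → g i ≤ g j)
    → (bmel : ℕ → ℕ) → (∀ b → IsBMEL G b (bmel b))
    → (sinc : ℕ) → IsSInc G sinc
    → (L : ℕ) (V : Fin L → Tree G × Tree G)
    → (∀ j → Regular G (Data.Product.proj₁ (V j)) × Regular G (Data.Product.proj₂ (V j)))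
    → EqlevelDecreasing G L V
    → IsNGSeq G n g L V
    → L ≤ ell bmel sinc n g
lemma2 G n g g-pos _ bmel isBMEL sinc isSInc L V _ decreasing ngSeq =
  decidable-stable (L ≤? ell bmel sinc n g)
    (bound n g L (g-pos 1 (s≤s z≤n)) (to-sequence n g L V decreasing ngSeq))
  where
  open Proof G
  open Bound bmel isBMEL sinc isSInc
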